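{- Let $\Gamma=K_{n,n}-nK_2$ with $n\geqslant 3$, and let $G\leqslant\mathrm{Aut}(\Gamma)$ be transitive on vertices and edges with $G^+=\mathrm{Diag}(\mathrm{Alt}(n)\times\mathrm{Alt}(n))$. Then $D(G)=\lceil\sqrt{n-1}\rceil$.
   Context: $D(G)$ is the smallest $k$ such that there is a partition of the vertex set into $k$ parts whose setwise stabilisers in $G$ intersect trivially. $\Gamma$ has parts $\Delta=\{v_1,\dots,v_n\}$, $\Delta'=\{u_1,\dots,u_n\}$, with non-edges exactly $\{v_i,u_i\}$ (the crown graph). $(g,g')\in\mathrm{Sym}(n)\times\mathrm{Sym}(n)$ acts by $v_i\mapsto v_{i^g}$, $u_i\mapsto u_{i^{g'}}$; $G^+$ is the index-two subgroup of $G$ preserving each part, and $\mathrm{Diag}(\mathrm{Alt}(n)\times\mathrm{Alt}(n))=\{(h,h):h\in\mathrm{Alt}(n)\}$. -}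

module Defs where

open import Data.Nat using (ℕ; _+_; _*_; _≤_; _<ᵇ_; _%_)
open import Data.Bool using (Bool; true; false; if_then_else_; _∧_)
open import Data.Fin using (Fin; toℕ)
open import Data.List using (List; map; allFin)
open import Data.Nat.ListAction using (sum)
open import Data.Sum using (_⊎_; inj₁; inj₂)
import Data.Sum as Sum
open import Data.Product using (Σ; _×_; _,_)
open import Data.Empty using (⊥)
open import Data.Unit using (⊤)
open import Relation.Binary.PropositionalEquality using (_≡_; _≢_)
open import Function.Bundles using (_↔_; Inverse)
open import Function.Construct.Identity using (↔-id)
open import Function.Construct.Composition using (_↔-∘_)
open import Function.Construct.Symmetry using (↔-sym)
open import Data.Fin.Permutation using (Permutation′; _⟨$⟩ʳ_)

-- Vertex set of the crown graph K_{n,n} - nK_2: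
-- inj₁ i is v_i (part Δ), inj₂ i is u_i (part Δ').
V : ℕ → Set
V n = Fin n ⊎ Fin n

Adj : ∀ {n} → V n → V n → Set
Adj (inj₁ i) (inj₁ j) = ⊥
Adj (inj₁ i) (inj₂ j) = i ≢ j
Adj (inj₂ i) (inj₁ j) = i ≢ j
Adj (inj₂ i) (inj₂ j) = ⊥

Perm : ℕ → Set
Perm n = V n ↔ V n

app : ∀ {n} → Perm n → V n → V n
app = Inverse.to

_≈ₚ_ : ∀ {n} → Perm n → Perm n → Set
π ≈ₚ σ = ∀ x → app π x ≡ app σ x

IsAut : ∀ {n} → Perm n → Set
IsAut {n} π = ∀ (x y : V n) → (Adj x y → Adj (app π x) (app π y)) × (Adj (app π x) (app π y) → Adj x y)

record IsSubgroupOfAut {n} (G : Perm n → Set) : Set where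
  field
    aut      : ∀ π → G π → IsAut π
    ext      : ∀ π σ → π ≈ₚ σ → G π → G σ
    has-id   : G (↔-id (V n))
    has-comp : ∀ π σ → G π → G σ → G (π ↔-∘ σ)
    has-inv  : ∀ π → G π → G (↔-sym π)

VertexTransitive : ∀ {n} → (Perm n → Set) → Set
VertexTransitive {n} G = ∀ (x y : V n) → Σ (Perm n) λ π → G π × app π x ≡ y

-- transitive on edges (unordered pairs {x,y} with x ~ y)
EdgeTransitive : ∀ {n} → (Perm n → Set) → Set
EdgeTransitive {n} G = ∀ (x y x′ y′ : V n) → Adj x y → Adj x′ y′ →
  Σ (Perm n) λ π → G π ×
    ((app π x ≡ x′ × app π y ≡ y′) ⊎ (app π x ≡ y′ × app π y ≡ x′))

inΔ : ∀ {n} → V n → Bool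
inΔ (inj₁ _) = true
inΔ (inj₂ _) = false

PreservesParts : ∀ {n} → Perm n → Set
PreservesParts π = ∀ x → inΔ (app π x) ≡ inΔ x

inversions : ∀ {n} → Permutation′ n → ℕ
inversions {n} h = sum (map (λ i → sum (map (λ j →
  if (toℕ i <ᵇ toℕ j) ∧ (toℕ (h ⟨$⟩ʳ j) <ᵇ toℕ (h ⟨$⟩ʳ i)) then 1 else 0)
  (allFin n))) (allFin n))

IsEven : ∀ {n} → Permutation′ n → Set
IsEven h = inversions h % 2 ≡ 0

diag : ∀ {n} → Permutation′ n → V n → V n
diag h = Sum.map (h ⟨$⟩ʳ_) (h ⟨$⟩ʳ_)

-- G⁺ = Diag(Alt(n) × Alt(n)), where G⁺ = {π ∈ G | π preserves each part}
PlusIsDiagAlt : ∀ {n} → (Perm n → Set) → Set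
PlusIsDiagAlt {n} G =
  (∀ π → G π → PreservesParts π →
     Σ (Permutation′ n) λ h → IsEven h × (∀ x → app π x ≡ diag h x))
  × (∀ (h : Permutation′ n) → IsEven h →
     Σ (Perm n) λ π → G π × PreservesParts π × (∀ x → app π x ≡ diag h x))

-- a partition of V n into k parts, as a colouring c : V n → Fin k;
-- π stabilises every part setwise iff c ∘ π = c.
StabilisesAllParts : ∀ {n k} → (V n → Fin k) → Perm n → Set
StabilisesAllParts c π = ∀ x → c (app π x) ≡ c x

Distinguishing : ∀ {n k} → (Perm n → Set) → (V n → Fin k) → Set
Distinguishing {n} G c = ∀ π → G π → StabilisesAllParts c π → π ≈ₚ ↔-id (V n)

IsDistinguishingNumber : ∀ {n} → (Perm n → Set) → ℕ → Set
IsDistinguishingNumber {n} G k =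
  Σ (V n → Fin k) (Distinguishing G)
  × (∀ m (c : V n → Fin m) → Distinguishing G c → k ≤ m)

IsCeilSqrt : ℕ → ℕ → Set
IsCeilSqrt m k = m ≤ k * k × (∀ j → m ≤ j * j → k ≤ j)

{-# OPTIONS --safe #-}
module Submission where

-- Write c⁺ i = (c v_i , c u_i) (pairColour c) for a colouring c of the crown graph.
-- An element (h , h) of G⁺ fixes every colour class iff h preserves c⁺, so c can
-- only be distinguishing if no nontrivial even permutation preserves c⁺.
-- Lower bound: with fewer than n - 1 values of c⁺, two pigeonhole collisions
-- {a , b} and {x , y} with b ∉ {x , y} give such a permutation, (a b)(x y).
-- Upper bound: if n - 1 ≤ k², give the indices 0 and 1 the same off-diagonal pair
-- (0 , 1) and all other indices distinct pairs.  The only nontrivial permutation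
-- preserving c⁺ is the odd transposition (0 1).  An automorphism swapping the parts
-- and fixing the colours sends v₀ and v₁ to vertices u_b₀ and u_b₁ whose pair is
-- (1 , 0); since that is not the pair shared by 0 and 1, b₀ = b₁, which is absurd.
-- Parity is read off inversion counts.  It is a homomorphism because g ∘ f reverses
-- the order of a pair iff exactly one of f, and g on its image, does; and the number
-- of pairs whose order g reverses does not depend on how they are labelled.

open import Data.Bool using (Bool; true; false; not; _∧_; _xor_; if_then_else_)
open import Data.Bool.Properties using (not-involutive; ∧-inverseʳ)
open import Data.Empty using (⊥)
open import Data.Fin using (Fin; zero; suc; toℕ; _≟_; punchIn; combine; remQuot; inject≤)
open import Data.Fin.Permutation using (Permutation′; _⟨$⟩ʳ_; _∘ₚ_; flip; id; _≈_; inverseʳ; transpose)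
open import Data.Fin.Properties
  using (toℕ-injective; pigeonhole; punchIn-injective; punchInᵢ≢i; <⇒≢; combine-injective; inject≤-injective; *↔×)
open import Data.List using (map; tabulate; allFin)
open import Data.Nat using (ℕ; zero; suc; _+_; _*_; _∸_; _≤_; s≤s; _<_; _<ᵇ_; _%_; ⌊_/2⌋; parity)
open import Data.Nat.ListAction as List using ()
open import Data.Nat.Properties using (+-0-commutativeMonoid; n≡⌊n+n/2⌋; m<n⇒m<1+n; ≮⇒≥)
open import Data.Parity.Base as ℙ using (Parity; 0ℙ; 1ℙ)
import Data.Parity.Properties as ℙᴾ
open import Data.Product using (Σ; ∃; _×_; _,_; proj₁; proj₂; uncurry; swap)
open import Data.Sum using (_⊎_; inj₁; inj₂; [_,_]′)
open import Data.Sum.Properties using (inj₁-injective)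
open import Function using (Injective; _∘_)
open import Function.Bundles using (Injection)
open import Function.Construct.Identity using (↔-id)
open import Function.Properties.Inverse using (↔⇒↣)
open import Relation.Binary.PropositionalEquality
open import Relation.Nullary using (¬_; Dec; yes; no; contradiction)
open import Algebra.Properties.CommutativeMonoid.Sum +-0-commutativeMonoid
  using (sum; sum-syntax; ∑-distrib-+; ∑-comm; ∑-permute; sum-cong-≗; sum-replicate-zero)
open import Defs

private
  variable
    n : ℕ

-- Inversions and parity

sum-map-tabulate : ∀ {A : Set} (f : A → ℕ) (g : Fin n → A) →
  List.sum (map f (tabulate g)) ≡ ∑[ i < n ] f (g i)
sum-map-tabulate {zero}  f g = refl
sum-map-tabulate {suc n} f g = cong (f (g zero) +_) (sum-map-tabulate f (g ∘ suc))

∑-zero : (f : Fin n → ℕ) → (∀ i → f i ≡ 0) → ∑[ i < n ] f i ≡ 0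
∑-zero {n} f f≡0 = trans (sum-cong-≗ f≡0) (sum-replicate-zero n)

∑∑-cong : {f g : Fin n → Fin n → ℕ} → (∀ i j → f i j ≡ g i j) →
  ∑[ i < n ] ∑[ j < n ] f i j ≡ ∑[ i < n ] ∑[ j < n ] g i j
∑∑-cong f≡g = sum-cong-≗ (λ i → sum-cong-≗ (f≡g i))

∑∑-distrib-+ : (f g : Fin n → Fin n → ℕ) →
  ∑[ i < n ] ∑[ j < n ] (f i j + g i j) ≡ ∑[ i < n ] ∑[ j < n ] f i j + ∑[ i < n ] ∑[ j < n ] g i j
∑∑-distrib-+ f g =
  trans (sum-cong-≗ (λ i → ∑-distrib-+ (f i) (g i))) (∑-distrib-+ (λ i → sum (f i)) (λ i → sum (g i)))

m+m≡n+n⇒m≡n : ∀ {m k} → m + m ≡ k + k → m ≡ k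
m+m≡n+n⇒m≡n {m} {k} eq = trans (n≡⌊n+n/2⌋ m) (trans (cong ⌊_/2⌋ eq) (sym (n≡⌊n+n/2⌋ k)))

⟦_⟧ : Bool → ℕ
⟦ b ⟧ = if b then 1 else 0

infix 4 _<ᶠ_

_<ᶠ_ : Fin n → Fin n → Bool
i <ᶠ j = toℕ i <ᵇ toℕ j

<ᵇ-irrefl : ∀ m → (m <ᵇ m) ≡ false
<ᵇ-irrefl zero    = refl
<ᵇ-irrefl (suc m) = <ᵇ-irrefl m

<ᵇ-flip : ∀ {m k} → m ≢ k → (k <ᵇ m) ≡ not (m <ᵇ k)
<ᵇ-flip {zero}  {zero}  m≢k = contradiction refl m≢k
<ᵇ-flip {zero}  {suc k} _   = refl
<ᵇ-flip {suc m} {zero}  _   = refl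
<ᵇ-flip {suc m} {suc k} m≢k = <ᵇ-flip (m≢k ∘ cong suc)

<ᶠ-irrefl : (i : Fin n) → (i <ᶠ i) ≡ false
<ᶠ-irrefl i = <ᵇ-irrefl (toℕ i)

<ᶠ-flip : {i j : Fin n} → i ≢ j → (j <ᶠ i) ≡ not (i <ᶠ j)
<ᶠ-flip i≢j = <ᵇ-flip (i≢j ∘ toℕ-injective)

<ᶠ-asym : (i j : Fin n) → (i <ᶠ j) ∧ (j <ᶠ i) ≡ false
<ᶠ-asym i j with i ≟ j
... | yes refl rewrite <ᶠ-irrefl i = refl
... | no i≢j   rewrite <ᶠ-flip i≢j = ∧-inverseʳ (i <ᶠ j)

pairCount : (Fin n → Fin n → Bool) → ℕ
pairCount {n} F = ∑[ i < n ] ∑[ j < n ] ⟦ (i <ᶠ j) ∧ F i j ⟧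

pairCount-cong : {F G : Fin n → Fin n → Bool} → (∀ i j → F i j ≡ G i j) → pairCount F ≡ pairCount G
pairCount-cong F≡G = ∑∑-cong (λ i j → cong (λ b → ⟦ (i <ᶠ j) ∧ b ⟧) (F≡G i j))

inversions≡pairCount : (π : Permutation′ n) → inversions π ≡ pairCount (λ i j → π ⟨$⟩ʳ j <ᶠ π ⟨$⟩ʳ i)
inversions≡pairCount {n} π =
  trans (sum-map-tabulate (λ i → List.sum (map (entry i) (allFin n))) (λ i → i))
        (sum-cong-≗ (λ i → sum-map-tabulate (entry i) (λ j → j)))
  where
  entry : Fin n → Fin n → ℕ
  entry i j = ⟦ (i <ᶠ j) ∧ (π ⟨$⟩ʳ j <ᶠ π ⟨$⟩ʳ i) ⟧

pairCount-double : (F : Fin n → Fin n → Bool) → (∀ i j → F i j ≡ F j i) → (∀ i → F i i ≡ false) →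
  pairCount F + pairCount F ≡ ∑[ i < n ] ∑[ j < n ] ⟦ F i j ⟧
pairCount-double {n} F F-sym F-irrefl = begin
  pairCount F + pairCount F
    ≡⟨ cong (pairCount F +_) (∑-comm (λ i j → ⟦ (i <ᶠ j) ∧ F i j ⟧)) ⟩
  pairCount F + ∑[ i < n ] ∑[ j < n ] ⟦ (j <ᶠ i) ∧ F j i ⟧
    ≡⟨ ∑∑-distrib-+ (λ i j → ⟦ (i <ᶠ j) ∧ F i j ⟧) (λ i j → ⟦ (j <ᶠ i) ∧ F j i ⟧) ⟨
  ∑[ i < n ] ∑[ j < n ] (⟦ (i <ᶠ j) ∧ F i j ⟧ + ⟦ (j <ᶠ i) ∧ F j i ⟧)
    ≡⟨ ∑∑-cong split ⟩
  ∑[ i < n ] ∑[ j < n ] ⟦ F i j ⟧ ∎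
  where
  open ≡-Reasoning
  count : ∀ a f → ⟦ a ∧ f ⟧ + ⟦ not a ∧ f ⟧ ≡ ⟦ f ⟧
  count true  true  = refl
  count true  false = refl
  count false true  = refl
  count false false = refl
  split : ∀ i j → ⟦ (i <ᶠ j) ∧ F i j ⟧ + ⟦ (j <ᶠ i) ∧ F j i ⟧ ≡ ⟦ F i j ⟧
  split i j with i ≟ j
  ... | yes refl rewrite F-irrefl i | <ᶠ-irrefl i = refl
  ... | no i≢j   rewrite <ᶠ-flip i≢j | F-sym j i = count (i <ᶠ j) (F i j)

pairCount-permute : (σ : Permutation′ n) (F : Fin n → Fin n → Bool) →
  (∀ i j → F i j ≡ F j i) → (∀ i → F i i ≡ false) →
  pairCount (λ i j → F (σ ⟨$⟩ʳ i) (σ ⟨$⟩ʳ j)) ≡ pairCount F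
pairCount-permute {n} σ F F-sym F-irrefl = m+m≡n+n⇒m≡n (begin
  pairCount Fσ + pairCount Fσ
    ≡⟨ pairCount-double Fσ (λ i j → F-sym _ _) (λ i → F-irrefl _) ⟩
  ∑[ i < n ] ∑[ j < n ] ⟦ F (σ ⟨$⟩ʳ i) (σ ⟨$⟩ʳ j) ⟧
    ≡⟨ sum-cong-≗ (λ i → ∑-permute (λ j → ⟦ F (σ ⟨$⟩ʳ i) j ⟧) σ) ⟨
  ∑[ i < n ] ∑[ j < n ] ⟦ F (σ ⟨$⟩ʳ i) j ⟧
    ≡⟨ ∑-permute (λ i → ∑[ j < n ] ⟦ F i j ⟧) σ ⟨
  ∑[ i < n ] ∑[ j < n ] ⟦ F i j ⟧
    ≡⟨ pairCount-double F F-sym F-irrefl ⟨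
  pairCount F + pairCount F ∎)
  where
  open ≡-Reasoning
  Fσ : Fin n → Fin n → Bool
  Fσ i j = F (σ ⟨$⟩ʳ i) (σ ⟨$⟩ʳ j)

pairCount-xor : (A B : Fin n → Fin n → Bool) →
  pairCount (λ i j → A i j xor B i j) + (pairCount (λ i j → A i j ∧ B i j) + pairCount (λ i j → A i j ∧ B i j))
    ≡ pairCount A + pairCount B
pairCount-xor {n} A B = begin
  pairCount X + (pairCount Y + pairCount Y)
    ≡⟨ cong (pairCount X +_) (∑∑-distrib-+ (entry Y) (entry Y)) ⟨
  pairCount X + ∑[ i < n ] ∑[ j < n ] (entry Y i j + entry Y i j)
    ≡⟨ ∑∑-distrib-+ (entry X) (λ i j → entry Y i j + entry Y i j) ⟨
  ∑[ i < n ] ∑[ j < n ] (entry X i j + (entry Y i j + entry Y i j))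
    ≡⟨ ∑∑-cong (λ i j → split (i <ᶠ j) (A i j) (B i j)) ⟩
  ∑[ i < n ] ∑[ j < n ] (entry A i j + entry B i j)
    ≡⟨ ∑∑-distrib-+ (entry A) (entry B) ⟩
  pairCount A + pairCount B ∎
  where
  open ≡-Reasoning
  X Y : Fin n → Fin n → Bool
  X i j = A i j xor B i j
  Y i j = A i j ∧ B i j
  entry : (Fin n → Fin n → Bool) → Fin n → Fin n → ℕ
  entry F i j = ⟦ (i <ᶠ j) ∧ F i j ⟧
  split : ∀ l a b → ⟦ l ∧ (a xor b) ⟧ + (⟦ l ∧ (a ∧ b) ⟧ + ⟦ l ∧ (a ∧ b) ⟧) ≡ ⟦ l ∧ a ⟧ + ⟦ l ∧ b ⟧
  split false a     b     = refl
  split true  true  true  = refl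
  split true  true  false = refl
  split true  false true  = refl
  split true  false false = refl

parity-+-double : ∀ x y → parity (x + (y + y)) ≡ parity x
parity-+-double x y = begin
  parity (x + (y + y))                   ≡⟨ ℙᴾ.+-homo-+ x (y + y) ⟩
  parity x ℙ.+ parity (y + y)            ≡⟨ cong (parity x ℙ.+_) (ℙᴾ.+-homo-+ y y) ⟩
  parity x ℙ.+ (parity y ℙ.+ parity y)   ≡⟨ cong (parity x ℙ.+_) (ℙᴾ.p+p≡0ℙ (parity y)) ⟩
  parity x ℙ.+ 0ℙ                        ≡⟨ ℙᴾ.+-identityʳ (parity x) ⟩
  parity x                               ∎
  where open ≡-Reasoning

parity-pairCount-xor : (A B : Fin n → Fin n → Bool) →
  parity (pairCount (λ i j → A i j xor B i j)) ≡ parity (pairCount A) ℙ.+ parity (pairCount B)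
parity-pairCount-xor A B = begin
  parity (pairCount X)                          ≡⟨ parity-+-double (pairCount X) (pairCount Y) ⟨
  parity (pairCount X + (pairCount Y + pairCount Y)) ≡⟨ cong parity (pairCount-xor A B) ⟩
  parity (pairCount A + pairCount B)            ≡⟨ ℙᴾ.+-homo-+ (pairCount A) (pairCount B) ⟩
  parity (pairCount A) ℙ.+ parity (pairCount B) ∎
  where
  open ≡-Reasoning
  X Y : Fin _ → Fin _ → Bool
  X i j = A i j xor B i j
  Y i j = A i j ∧ B i j

Flips : (Fin n → Fin n) → Fin n → Fin n → Bool
Flips f i j = (i <ᶠ j) xor (f i <ᶠ f j)

Flips-irrefl : (f : Fin n → Fin n) → ∀ i → Flips f i i ≡ false
Flips-irrefl f i rewrite <ᶠ-irrefl i | <ᶠ-irrefl (f i) = refl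

Flips-sym : {f : Fin n → Fin n} → Injective _≡_ _≡_ f → ∀ i j → Flips f i j ≡ Flips f j i
Flips-sym {f = f} f-inj i j with i ≟ j
... | yes refl = refl
... | no i≢j rewrite <ᶠ-flip i≢j | <ᶠ-flip (i≢j ∘ f-inj) = xor≡not-xor-not (i <ᶠ j) (f i <ᶠ f j)
  where
  xor≡not-xor-not : ∀ a b → a xor b ≡ not a xor not b
  xor≡not-xor-not true  b = refl
  xor≡not-xor-not false b = sym (not-involutive b)

Flips-∘ : (f g : Fin n → Fin n) → ∀ i j → Flips (g ∘ f) i j ≡ Flips f i j xor Flips g (f i) (f j)
Flips-∘ f g i j = xor-through (i <ᶠ j) (f i <ᶠ f j) (g (f i) <ᶠ g (f j))
  where
  xor-through : ∀ a b c → a xor c ≡ (a xor b) xor (b xor c)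
  xor-through true  true  c = refl
  xor-through true  false c = refl
  xor-through false true  c = sym (not-involutive c)
  xor-through false false c = refl

⟨$⟩ʳ-injective : (π : Permutation′ n) → Injective _≡_ _≡_ (π ⟨$⟩ʳ_)
⟨$⟩ʳ-injective π = Injection.injective (↔⇒↣ π)

inversions≡pairCount-Flips : (π : Permutation′ n) → inversions π ≡ pairCount (Flips (π ⟨$⟩ʳ_))
inversions≡pairCount-Flips π = trans (inversions≡pairCount π) (∑∑-cong inverted⇔flipped)
  where
  not≡xor : ∀ a b → ⟦ a ∧ not b ⟧ ≡ ⟦ a ∧ (a xor b) ⟧
  not≡xor true  b = refl
  not≡xor false b = refl
  inverted⇔flipped : ∀ i j → ⟦ (i <ᶠ j) ∧ (π ⟨$⟩ʳ j <ᶠ π ⟨$⟩ʳ i) ⟧ ≡ ⟦ (i <ᶠ j) ∧ Flips (π ⟨$⟩ʳ_) i j ⟧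
  inverted⇔flipped i j with i ≟ j
  ... | yes refl rewrite <ᶠ-irrefl i = refl
  ... | no i≢j   rewrite <ᶠ-flip (i≢j ∘ ⟨$⟩ʳ-injective π) = not≡xor (i <ᶠ j) (π ⟨$⟩ʳ i <ᶠ π ⟨$⟩ʳ j)

parityₚ : Permutation′ n → Parity
parityₚ π = parity (inversions π)

parityₚ-∘ₚ : (σ τ : Permutation′ n) → parityₚ (σ ∘ₚ τ) ≡ parityₚ σ ℙ.+ parityₚ τ
parityₚ-∘ₚ σ τ = begin
  parity (inversions (σ ∘ₚ τ))
    ≡⟨ cong parity (inversions≡pairCount-Flips (σ ∘ₚ τ)) ⟩
  parity (pairCount (Flips (t ∘ s)))
    ≡⟨ cong parity (pairCount-cong (Flips-∘ s t)) ⟩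
  parity (pairCount (λ i j → Flips s i j xor Flips t (s i) (s j)))
    ≡⟨ parity-pairCount-xor (Flips s) (λ i j → Flips t (s i) (s j)) ⟩
  parity (pairCount (Flips s)) ℙ.+ parity (pairCount (λ i j → Flips t (s i) (s j)))
    ≡⟨ cong (λ k → parity (pairCount (Flips s)) ℙ.+ parity k)
         (pairCount-permute σ (Flips t) (Flips-sym (⟨$⟩ʳ-injective τ)) (Flips-irrefl t)) ⟩
  parity (pairCount (Flips s)) ℙ.+ parity (pairCount (Flips t))
    ≡⟨ cong₂ (λ k l → parity k ℙ.+ parity l) (inversions≡pairCount-Flips σ) (inversions≡pairCount-Flips τ) ⟨
  parityₚ σ ℙ.+ parityₚ τ ∎
  where
  open ≡-Reasoning
  s t : Fin _ → Fin _
  s = σ ⟨$⟩ʳ_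
  t = τ ⟨$⟩ʳ_

parityₚ-cong : (σ τ : Permutation′ n) → σ ≈ τ → parityₚ σ ≡ parityₚ τ
parityₚ-cong σ τ σ≈τ = cong parity (begin
  inversions σ                              ≡⟨ inversions≡pairCount σ ⟩
  pairCount (λ i j → σ ⟨$⟩ʳ j <ᶠ σ ⟨$⟩ʳ i)  ≡⟨ pairCount-cong (λ i j → cong₂ _<ᶠ_ (σ≈τ j) (σ≈τ i)) ⟩
  pairCount (λ i j → τ ⟨$⟩ʳ j <ᶠ τ ⟨$⟩ʳ i)  ≡⟨ inversions≡pairCount τ ⟨
  inversions τ                              ∎)
  where open ≡-Reasoning

parityₚ-id : parityₚ (id {n}) ≡ 0ℙ
parityₚ-id {n} = cong parity (trans (inversions≡pairCount (id {n}))
  (∑-zero row (λ i → ∑-zero (entry i) (λ j → cong ⟦_⟧ (<ᶠ-asym i j)))))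
  where
  entry : Fin n → Fin n → ℕ
  entry i j = ⟦ (i <ᶠ j) ∧ (j <ᶠ i) ⟧
  row : Fin n → ℕ
  row i = ∑[ j < n ] entry i j

parityₚ-conjugate : (σ π : Permutation′ n) → parityₚ (flip σ ∘ₚ π ∘ₚ σ) ≡ parityₚ π
parityₚ-conjugate {n} σ π = begin
  parityₚ (flip σ ∘ₚ π ∘ₚ σ)                     ≡⟨ parityₚ-∘ₚ (flip σ) (π ∘ₚ σ) ⟩
  parityₚ (flip σ) ℙ.+ parityₚ (π ∘ₚ σ)          ≡⟨ cong (parityₚ (flip σ) ℙ.+_) (parityₚ-∘ₚ π σ) ⟩
  parityₚ (flip σ) ℙ.+ (parityₚ π ℙ.+ parityₚ σ) ≡⟨ cong (parityₚ (flip σ) ℙ.+_) (ℙᴾ.+-comm (parityₚ π) (parityₚ σ)) ⟩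
  parityₚ (flip σ) ℙ.+ (parityₚ σ ℙ.+ parityₚ π) ≡⟨ ℙᴾ.+-assoc (parityₚ (flip σ)) (parityₚ σ) (parityₚ π) ⟨
  parityₚ (flip σ) ℙ.+ parityₚ σ ℙ.+ parityₚ π   ≡⟨ cong (ℙ._+ parityₚ π) (parityₚ-∘ₚ (flip σ) σ) ⟨
  parityₚ (flip σ ∘ₚ σ) ℙ.+ parityₚ π            ≡⟨ cong (ℙ._+ parityₚ π) flip-σ∘σ-even ⟩
  0ℙ ℙ.+ parityₚ π                               ≡⟨⟩
  parityₚ π                                      ∎
  where
  open ≡-Reasoning
  flip-σ∘σ-even : parityₚ (flip σ ∘ₚ σ) ≡ 0ℙ
  flip-σ∘σ-even = trans (parityₚ-cong (flip σ ∘ₚ σ) id (λ _ → inverseʳ σ)) (parityₚ-id {n})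

%2≡0⇒parity≡0ℙ : ∀ m → m % 2 ≡ 0 → parity m ≡ 0ℙ
%2≡0⇒parity≡0ℙ zero          _ = refl
%2≡0⇒parity≡0ℙ (suc zero)    ()
%2≡0⇒parity≡0ℙ (suc (suc m)) = %2≡0⇒parity≡0ℙ m

parity≡0ℙ⇒%2≡0 : ∀ m → parity m ≡ 0ℙ → m % 2 ≡ 0
parity≡0ℙ⇒%2≡0 zero          _ = refl
parity≡0ℙ⇒%2≡0 (suc zero)    ()
parity≡0ℙ⇒%2≡0 (suc (suc m)) = parity≡0ℙ⇒%2≡0 m

transpose-matchˡ : (i j : Fin n) → transpose i j ⟨$⟩ʳ i ≡ j
transpose-matchˡ i j with i ≟ i
... | yes _   = refl
... | no i≢i = contradiction refl i≢i

transpose-matchʳ : (i j : Fin n) → transpose i j ⟨$⟩ʳ j ≡ i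
transpose-matchʳ i j with j ≟ i
... | yes j≡i = j≡i
... | no _ with j ≟ j
...   | yes _   = refl
...   | no j≢j = contradiction refl j≢j

transpose-other : {i j k : Fin n} → k ≢ i → k ≢ j → transpose i j ⟨$⟩ʳ k ≡ k
transpose-other {i = i} {j} {k} k≢i k≢j with k ≟ i
... | yes k≡i = contradiction k≡i k≢i
... | no _ with k ≟ j
...   | yes k≡j = contradiction k≡j k≢j
...   | no _    = refl

transpose-preserves : {A : Set} (f : Fin n → A) {i j : Fin n} → f i ≡ f j →
  ∀ k → f (transpose i j ⟨$⟩ʳ k) ≡ f k
transpose-preserves f {i} {j} fi≡fj k = by-cases (k ≟ i) (k ≟ j)
  where
  by-cases : Dec (k ≡ i) → Dec (k ≡ j) → f (transpose i j ⟨$⟩ʳ k) ≡ f k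
  by-cases (yes refl) _          = trans (cong f (transpose-matchˡ k j)) (sym fi≡fj)
  by-cases (no _)     (yes refl) = trans (cong f (transpose-matchʳ i k)) fi≡fj
  by-cases (no k≢i)   (no k≢j)   = cong f (transpose-other k≢i k≢j)

transpose-permute : (σ : Permutation′ n) (i j k : Fin n) →
  σ ⟨$⟩ʳ (transpose i j ⟨$⟩ʳ k) ≡ transpose (σ ⟨$⟩ʳ i) (σ ⟨$⟩ʳ j) ⟨$⟩ʳ (σ ⟨$⟩ʳ k)
transpose-permute σ i j k = by-cases (k ≟ i) (k ≟ j)
  where
  σ[_] : Fin _ → Fin _
  σ[ x ] = σ ⟨$⟩ʳ x
  by-cases : Dec (k ≡ i) → Dec (k ≡ j) → σ[ transpose i j ⟨$⟩ʳ k ] ≡ transpose σ[ i ] σ[ j ] ⟨$⟩ʳ σ[ k ]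
  by-cases (yes refl) _          = trans (cong σ[_] (transpose-matchˡ k j)) (sym (transpose-matchˡ σ[ k ] σ[ j ]))
  by-cases (no _)     (yes refl) = trans (cong σ[_] (transpose-matchʳ i k)) (sym (transpose-matchʳ σ[ i ] σ[ k ]))
  by-cases (no k≢i)   (no k≢j)   = trans (cong σ[_] (transpose-other k≢i k≢j))
                                     (sym (transpose-other (k≢i ∘ ⟨$⟩ʳ-injective σ) (k≢j ∘ ⟨$⟩ʳ-injective σ)))

parityₚ-transpose-permute : (σ : Permutation′ n) (i j : Fin n) →
  parityₚ (transpose (σ ⟨$⟩ʳ i) (σ ⟨$⟩ʳ j)) ≡ parityₚ (transpose i j)
parityₚ-transpose-permute σ i j = trans
  (parityₚ-cong (transpose (σ ⟨$⟩ʳ i) (σ ⟨$⟩ʳ j)) (flip σ ∘ₚ transpose i j ∘ₚ σ) conjugated)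
  (parityₚ-conjugate σ (transpose i j))
  where
  conjugated : transpose (σ ⟨$⟩ʳ i) (σ ⟨$⟩ʳ j) ≈ flip σ ∘ₚ transpose i j ∘ₚ σ
  conjugated k = sym (trans (transpose-permute σ i j (flip σ ⟨$⟩ʳ k))
                            (cong (transpose (σ ⟨$⟩ʳ i) (σ ⟨$⟩ʳ j) ⟨$⟩ʳ_) (inverseʳ σ)))

-- Rows 0 and 1 reduce to 1 + 0 and 0; the later rows vanish by asymmetry of <.
inversions-transpose₀₁ : ∀ {r} → inversions (transpose {2 + r} zero (suc zero)) ≡ 1
inversions-transpose₀₁ {r} = trans (inversions≡pairCount (transpose {2 + r} zero (suc zero)))
  (cong₂ (λ a b → suc a + b) (sum-replicate-zero r)
         (cong₂ _+_ (sum-replicate-zero r) (∑-zero row (λ k → ∑-zero (entry k) (λ l → cong ⟦_⟧ (<ᶠ-asym k l))))))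
  where
  entry : Fin r → Fin r → ℕ
  entry k l = ⟦ (k <ᶠ l) ∧ (l <ᶠ k) ⟧
  row : Fin r → ℕ
  row k = ∑[ l < r ] entry k l

parityₚ-transpose₀ : ∀ {r} {j : Fin (2 + r)} → j ≢ zero → parityₚ (transpose zero j) ≡ 1ℙ
parityₚ-transpose₀ {r} {j} j≢0 = begin
  parityₚ (transpose zero j)                         ≡⟨ cong₂ (λ a b → parityₚ (transpose a b)) σ0≡0 σ1≡j ⟨
  parityₚ (transpose (σ ⟨$⟩ʳ zero) (σ ⟨$⟩ʳ suc zero)) ≡⟨ parityₚ-transpose-permute σ zero (suc zero) ⟩
  parityₚ (transpose {2 + r} zero (suc zero))        ≡⟨ cong parity (inversions-transpose₀₁ {r}) ⟩
  1ℙ                                                 ∎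
  where
  open ≡-Reasoning
  σ : Permutation′ (2 + r)
  σ = transpose (suc zero) j
  σ0≡0 : σ ⟨$⟩ʳ zero ≡ zero
  σ0≡0 = transpose-other {i = suc zero} (λ ()) (j≢0 ∘ sym)
  σ1≡j : σ ⟨$⟩ʳ suc zero ≡ j
  σ1≡j = transpose-matchˡ (suc zero) j

parityₚ-transpose : {i j : Fin n} → i ≢ j → parityₚ (transpose i j) ≡ 1ℙ
parityₚ-transpose {suc zero}    {zero} {zero} i≢j = contradiction refl i≢j
parityₚ-transpose {suc (suc r)} {i}    {j}    i≢j = begin
  parityₚ (transpose i j)                       ≡⟨ cong₂ (λ a b → parityₚ (transpose a b)) σ0≡i (inverseʳ σ) ⟨
  parityₚ (transpose (σ ⟨$⟩ʳ zero) (σ ⟨$⟩ʳ j′)) ≡⟨ parityₚ-transpose-permute σ zero j′ ⟩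
  parityₚ (transpose zero j′)                   ≡⟨ parityₚ-transpose₀ j′≢0 ⟩
  1ℙ                                            ∎
  where
  open ≡-Reasoning
  σ : Permutation′ (2 + r)
  σ = transpose zero i
  j′ : Fin (2 + r)
  j′ = flip σ ⟨$⟩ʳ j
  σ0≡i : σ ⟨$⟩ʳ zero ≡ i
  σ0≡i = transpose-matchˡ zero i
  j′≢0 : j′ ≢ zero
  j′≢0 j′≡0 = i≢j (trans (sym σ0≡i) (trans (cong (σ ⟨$⟩ʳ_) (sym j′≡0)) (inverseʳ σ)))

-- Lower bound

alternating-pigeonhole : ∀ {s} → s < n → (f : Fin (suc n) → Fin s) →
  ∃ λ (h : Permutation′ (suc n)) → IsEven h × (∀ i → f (h ⟨$⟩ʳ i) ≡ f i) × ¬ h ≈ id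
alternating-pigeonhole {n} s<n f
  with a , b , a<b , fa≡fb ← pigeonhole (m<n⇒m<1+n s<n) f
  with x′ , y′ , x′<y′ , fx≡fy ← pigeonhole s<n (f ∘ punchIn b)
  = h , h-even , h-preserves , h-nontrivial
  where
  x y : Fin (suc n)
  x = punchIn b x′
  y = punchIn b y′
  x≢y : x ≢ y
  x≢y = <⇒≢ x′<y′ ∘ punchIn-injective b x′ y′
  h : Permutation′ (suc n)
  h = transpose x y ∘ₚ transpose a b
  h-even : IsEven h
  h-even = parity≡0ℙ⇒%2≡0 (inversions h) (begin
    parityₚ h                                            ≡⟨ parityₚ-∘ₚ (transpose x y) (transpose a b) ⟩
    parityₚ (transpose x y) ℙ.+ parityₚ (transpose a b)
      ≡⟨ cong₂ ℙ._+_ (parityₚ-transpose x≢y) (parityₚ-transpose (<⇒≢ a<b)) ⟩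
    1ℙ ℙ.+ 1ℙ                                            ≡⟨⟩
    0ℙ                                                   ∎)
    where open ≡-Reasoning
  h-preserves : ∀ i → f (h ⟨$⟩ʳ i) ≡ f i
  h-preserves i = trans (transpose-preserves f fa≡fb (transpose x y ⟨$⟩ʳ i)) (transpose-preserves f fx≡fy i)
  h-nontrivial : ¬ h ≈ id
  h-nontrivial h≈id with x ≟ a
  ... | yes x≡a = punchInᵢ≢i b y′ (sym (begin
    b                     ≡⟨ transpose-matchˡ a b ⟨
    transpose a b ⟨$⟩ʳ a  ≡⟨ cong (transpose a b ⟨$⟩ʳ_) (trans (sym x≡a) (sym (transpose-matchʳ x y))) ⟩
    h ⟨$⟩ʳ y              ≡⟨ h≈id y ⟩
    y                     ∎))
    where open ≡-Reasoning
  ... | no x≢a = x≢y (begin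
    x                     ≡⟨ transpose-other x≢a (punchInᵢ≢i b x′) ⟨
    transpose a b ⟨$⟩ʳ x  ≡⟨ cong (transpose a b ⟨$⟩ʳ_) (transpose-matchʳ x y) ⟨
    h ⟨$⟩ʳ y              ≡⟨ h≈id y ⟩
    y                     ∎)
    where open ≡-Reasoning

pairColour : ∀ {m} → (V n → Fin m) → Fin n → Fin m × Fin m
pairColour c i = c (inj₁ i) , c (inj₂ i)

pairColour-invariant⇒diag-stabilises : ∀ {m} (c : V n → Fin m) (h : Permutation′ n) →
  (∀ i → pairColour c (h ⟨$⟩ʳ i) ≡ pairColour c i) → ∀ x → c (diag h x) ≡ c x
pairColour-invariant⇒diag-stabilises c h invariant (inj₁ i) = cong proj₁ (invariant i)
pairColour-invariant⇒diag-stabilises c h invariant (inj₂ i) = cong proj₂ (invariant i)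

diag-stabilises⇒pairColour-invariant : ∀ {m} (c : V n → Fin m) (h : Permutation′ n) →
  (∀ x → c (diag h x) ≡ c x) → ∀ i → pairColour c (h ⟨$⟩ʳ i) ≡ pairColour c i
diag-stabilises⇒pairColour-invariant c h stabilises i = cong₂ _,_ (stabilises (inj₁ i)) (stabilises (inj₂ i))

even-pairColour-invariant⇒id : ∀ {m} {G : Perm n → Set} {c : V n → Fin m} →
  PlusIsDiagAlt G → Distinguishing G c →
  (h : Permutation′ n) → IsEven h → (∀ i → pairColour c (h ⟨$⟩ʳ i) ≡ pairColour c i) → h ≈ id
even-pairColour-invariant⇒id {n} {G = G} {c} plus c-dist h h-even invariant = from-element (proj₂ plus h h-even)
  where
  from-element : (Σ (Perm n) λ π → G π × PreservesParts π × (∀ x → app π x ≡ diag h x)) → h ≈ id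
  from-element (π , Gπ , _ , π≗h) i =
    inj₁-injective (trans (sym (π≗h (inj₁ i))) (c-dist π Gπ π-stabilises (inj₁ i)))
    where
    π-stabilises : StabilisesAllParts c π
    π-stabilises x = trans (cong c (π≗h x)) (pairColour-invariant⇒diag-stabilises c h invariant x)

distinguishing-lowerBound : ∀ {m} {G : Perm (suc n) → Set} {c : V (suc n) → Fin m} →
  PlusIsDiagAlt G → Distinguishing G c → n ≤ m * m
distinguishing-lowerBound {n} {m} {c = c} plus c-dist =
  ≮⇒≥ (λ m²<n → no-even-symmetry (alternating-pigeonhole m²<n code))
  where
  code : Fin (suc n) → Fin (m * m)
  code = uncurry combine ∘ pairColour c
  no-even-symmetry : ¬ ∃ λ h → IsEven h × (∀ i → code (h ⟨$⟩ʳ i) ≡ code i) × ¬ h ≈ id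
  no-even-symmetry (h , h-even , h-preserves , h-nontrivial) =
    h-nontrivial (even-pairColour-invariant⇒id plus c-dist h h-even pairColour-invariant)
    where
    pairColour-invariant : ∀ i → pairColour c (h ⟨$⟩ʳ i) ≡ pairColour c i
    pairColour-invariant i = uncurry (cong₂ _,_)
      (combine-injective (c (inj₁ (h ⟨$⟩ʳ i))) (c (inj₂ (h ⟨$⟩ʳ i))) (c (inj₁ i)) (c (inj₂ i)) (h-preserves i))

-- Upper bound

merge₀₁ : Fin (2 + n) → Fin (suc n)
merge₀₁ zero    = zero
merge₀₁ (suc i) = i

merge₀₁≡zero : (x : Fin (2 + n)) → merge₀₁ x ≡ zero → x ≡ zero ⊎ x ≡ suc zero
merge₀₁≡zero zero          _ = inj₁ refl
merge₀₁≡zero (suc zero)    _ = inj₂ refl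
merge₀₁≡zero (suc (suc x)) ()

merge₀₁≡suc : (x : Fin (2 + n)) {k : Fin n} → merge₀₁ x ≡ suc k → x ≡ suc (suc k)
merge₀₁≡suc (suc x) refl = refl

merge₀₁-stabiliser : (h : Permutation′ (2 + n)) → (∀ i → merge₀₁ (h ⟨$⟩ʳ i) ≡ merge₀₁ i) →
  h ≈ id ⊎ h ≈ transpose zero (suc zero)
merge₀₁-stabiliser h invariant = by-cases (merge₀₁≡zero _ (invariant zero)) (merge₀₁≡zero _ (invariant (suc zero)))
  where
  fixes : ∀ k → h ⟨$⟩ʳ suc (suc k) ≡ suc (suc k)
  fixes k = merge₀₁≡suc _ (invariant (suc (suc k)))
  h0≢h1 : h ⟨$⟩ʳ zero ≢ h ⟨$⟩ʳ suc zero
  h0≢h1 = (λ ()) ∘ ⟨$⟩ʳ-injective h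
  by-cases : h ⟨$⟩ʳ zero ≡ zero ⊎ h ⟨$⟩ʳ zero ≡ suc zero → h ⟨$⟩ʳ suc zero ≡ zero ⊎ h ⟨$⟩ʳ suc zero ≡ suc zero →
    h ≈ id ⊎ h ≈ transpose zero (suc zero)
  by-cases (inj₁ h0≡0) (inj₁ h1≡0) = contradiction (trans h0≡0 (sym h1≡0)) h0≢h1
  by-cases (inj₂ h0≡1) (inj₂ h1≡1) = contradiction (trans h0≡1 (sym h1≡1)) h0≢h1
  by-cases (inj₁ h0≡0) (inj₂ h1≡1) = inj₁ λ { zero → h0≡0 ; (suc zero) → h1≡1 ; (suc (suc k)) → fixes k }
  by-cases (inj₂ h0≡1) (inj₁ h1≡0) = inj₂ λ { zero → h0≡1 ; (suc zero) → h1≡0 ; (suc (suc k)) → fixes k }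

adjacent-sides : {x y : V n} → Adj x y → inΔ x ≡ not (inΔ y)
adjacent-sides {x = inj₁ _} {inj₂ _} _ = refl
adjacent-sides {x = inj₂ _} {inj₁ _} _ = refl

SwapsParts : Perm n → Set
SwapsParts {n} π = ∀ (x : V n) → inΔ (app π x) ≡ not (inΔ x)

-- For n ≥ 3 any two vertices of one part have a common neighbour, so π moves each part as a block.
preserves-or-swaps : ∀ {r} {π : Perm (3 + r)} → IsAut π → PreservesParts π ⊎ SwapsParts π
preserves-or-swaps {r} {π} π-aut = by-side (inΔ (app π (inj₁ zero))) refl
  where
  avoid : (i : Fin (3 + r)) → ∃ λ k → zero ≢ k × i ≢ k
  avoid zero          = suc zero , (λ ()) , (λ ())
  avoid (suc zero)    = suc (suc zero) , (λ ()) , (λ ())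
  avoid (suc (suc i)) = suc zero , (λ ()) , (λ ())
  image-sides : ∀ {x y} → Adj x y → inΔ (app π x) ≡ not (inΔ (app π y))
  image-sides x~y = adjacent-sides (proj₁ (π-aut _ _) x~y)
  side-v : ∀ i → inΔ (app π (inj₁ i)) ≡ inΔ (app π (inj₁ zero))
  side-v i = let k , 0≢k , i≢k = avoid i in
    trans (image-sides {inj₁ i} {inj₂ k} i≢k) (sym (image-sides {inj₁ zero} {inj₂ k} 0≢k))
  side-u : ∀ i → inΔ (app π (inj₂ i)) ≡ not (inΔ (app π (inj₁ zero)))
  side-u i = let k , _ , i≢k = avoid i in
    trans (image-sides {inj₂ i} {inj₁ k} i≢k) (cong not (side-v k))
  by-side : ∀ s → inΔ (app π (inj₁ zero)) ≡ s → PreservesParts π ⊎ SwapsParts π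
  by-side true  v₀-side = inj₁ λ { (inj₁ i) → trans (side-v i) v₀-side
                                 ; (inj₂ i) → trans (side-u i) (cong not v₀-side) }
  by-side false v₀-side = inj₂ λ { (inj₁ i) → trans (side-v i) v₀-side
                                 ; (inj₂ i) → trans (side-u i) (cong not v₀-side) }

swapped-matching : {π : Perm n} → IsAut π → SwapsParts π →
  ∀ i → ∃ λ b → app π (inj₁ i) ≡ inj₂ b × app π (inj₂ i) ≡ inj₁ b
swapped-matching {π = π} π-aut π-swaps i with app π (inj₁ i) in πv | app π (inj₂ i) in πu
... | inj₁ _ | _      = contradiction (trans (cong inΔ (sym πv)) (π-swaps (inj₁ i))) λ ()
... | inj₂ _ | inj₂ _ = contradiction (trans (cong inΔ (sym πu)) (π-swaps (inj₂ i))) λ ()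
... | inj₂ b | inj₁ d with b ≟ d
...   | yes refl = b , refl , refl
...   | no b≢d   = contradiction refl (proj₂ (π-aut (inj₁ i) (inj₂ i)) (subst₂ Adj (sym πv) (sym πu) b≢d))

diag-id : {h : Permutation′ n} → h ≈ id → ∀ x → diag h x ≡ x
diag-id h≈id (inj₁ i) = cong inj₁ (h≈id i)
diag-id h≈id (inj₂ i) = cong inj₂ (h≈id i)

swapped-pairColour : ∀ {m} (c : V n → Fin m) {π : Perm n} → StabilisesAllParts c π →
  ∀ {i b} → app π (inj₁ i) ≡ inj₂ b → app π (inj₂ i) ≡ inj₁ b → pairColour c b ≡ swap (pairColour c i)
swapped-pairColour c π-stab πv≡u πu≡v =
  cong₂ _,_ (trans (cong c (sym πu≡v)) (π-stab _)) (trans (cong c (sym πv≡u)) (π-stab _))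

-- The transposition sends the merged class to 1, whose (quotient , remainder) pair (0 , 1) is off the diagonal.
pairEncoding : ∀ {r k} → 2 + r ≤ (2 + k) * (2 + k) → Fin (2 + r) → Fin (2 + k) × Fin (2 + k)
pairEncoding {k = k} n-1≤k² i = remQuot {2 + k} (2 + k) (inject≤ (transpose zero (suc zero) ⟨$⟩ʳ i) n-1≤k²)

pairEncoding-injective : ∀ {r k} (n-1≤k² : 2 + r ≤ (2 + k) * (2 + k)) → Injective _≡_ _≡_ (pairEncoding n-1≤k²)
pairEncoding-injective {k = k} n-1≤k² =
  ⟨$⟩ʳ-injective (transpose zero (suc zero))
  ∘ inject≤-injective n-1≤k² n-1≤k² _ _
  ∘ Injection.injective (↔⇒↣ (*↔× {2 + k} {2 + k}))

crownColouring : ∀ {r k} → 2 + r ≤ (2 + k) * (2 + k) → V (3 + r) → Fin (2 + k)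
crownColouring n-1≤k² (inj₁ i) = proj₁ (pairEncoding n-1≤k² (merge₀₁ i))
crownColouring n-1≤k² (inj₂ i) = proj₂ (pairEncoding n-1≤k² (merge₀₁ i))

module _ {r k} (n-1≤k² : 2 + r ≤ (2 + k) * (2 + k)) where

  private
    c : V (3 + r) → Fin (2 + k)
    c = crownColouring n-1≤k²

  crownColouring-preserving-trivial : {G : Perm (3 + r) → Set} → PlusIsDiagAlt G →
    ∀ {π} → G π → PreservesParts π → StabilisesAllParts c π → π ≈ₚ ↔-id (V (3 + r))
  crownColouring-preserving-trivial plus {π} Gπ π-preserves π-stab = from-diag (proj₁ plus π Gπ π-preserves)
    where
    from-diag : (∃ λ h → IsEven h × (∀ x → app π x ≡ diag h x)) → π ≈ₚ ↔-id (V (3 + r))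
    from-diag (h , h-even , π≗h) = from-stabiliser (merge₀₁-stabiliser h merge₀₁-invariant)
      where
      merge₀₁-invariant : ∀ i → merge₀₁ (h ⟨$⟩ʳ i) ≡ merge₀₁ i
      merge₀₁-invariant = pairEncoding-injective n-1≤k² ∘ diag-stabilises⇒pairColour-invariant c h
        (λ x → trans (cong c (sym (π≗h x))) (π-stab x))
      from-stabiliser : h ≈ id ⊎ h ≈ transpose zero (suc zero) → π ≈ₚ ↔-id (V (3 + r))
      from-stabiliser (inj₁ h≈id) x = trans (π≗h x) (diag-id {h = h} h≈id x)
      from-stabiliser (inj₂ h≈t)    = contradiction (trans (sym (%2≡0⇒parity≡0ℙ (inversions h) h-even)) h-odd) λ ()
        where
        h-odd : parityₚ h ≡ 1ℙ
        h-odd = trans (parityₚ-cong h (transpose zero (suc zero)) h≈t)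
                      (parityₚ-transpose {3 + r} {zero} {suc zero} (λ ()))

  crownColouring-swapping-impossible : ∀ {π} → IsAut π → SwapsParts π → ¬ StabilisesAllParts c π
  crownColouring-swapping-impossible {π} π-aut π-swaps π-stab =
    images-collide (swapped-matching {π = π} π-aut π-swaps zero)
                   (swapped-matching {π = π} π-aut π-swaps (suc zero))
    where
    Matched : Fin (3 + r) → Set
    Matched i = ∃ λ b → app π (inj₁ i) ≡ inj₂ b × app π (inj₂ i) ≡ inj₁ b
    images-collide : Matched zero → Matched (suc zero) → ⊥
    images-collide (b₀ , πv₀ , πu₀) (b₁ , πv₁ , πu₁) = by-class (merge₀₁ b₀) refl
      where
      b₀-pair : pairEncoding n-1≤k² (merge₀₁ b₀) ≡ (suc zero , zero)
      b₀-pair = swapped-pairColour c {π} π-stab {zero} {b₀} πv₀ πu₀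
      same-class : merge₀₁ b₀ ≡ merge₀₁ b₁
      same-class = pairEncoding-injective n-1≤k²
        (trans b₀-pair (sym (swapped-pairColour c {π} π-stab {suc zero} {b₁} πv₁ πu₁)))
      by-class : ∀ m → merge₀₁ b₀ ≡ m → ⊥
      by-class zero    b₀↦0 = contradiction (trans (cong (pairEncoding n-1≤k²) (sym b₀↦0)) b₀-pair) λ ()
      by-class (suc j) b₀↦j = contradiction
        (Injection.injective (↔⇒↣ π) (trans πv₀ (trans (cong inj₂ b₀≡b₁) (sym πv₁)))) λ ()
        where
        b₀≡b₁ : b₀ ≡ b₁
        b₀≡b₁ = trans (merge₀₁≡suc b₀ b₀↦j) (sym (merge₀₁≡suc b₁ (trans (sym same-class) b₀↦j)))

distinguishing-upperBound : ∀ {r k} {G : Perm (3 + r) → Set} → IsSubgroupOfAut G → PlusIsDiagAlt G →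
  2 + r ≤ k * k → Σ (V (3 + r) → Fin k) (Distinguishing G)
distinguishing-upperBound {k = zero}        _   _    ()
distinguishing-upperBound {k = suc zero}    _   _    (s≤s ())
distinguishing-upperBound {r} {suc (suc k)} {G} sub plus n-1≤k² = crownColouring n-1≤k² , distinguishing
  where
  distinguishing : Distinguishing G (crownColouring n-1≤k²)
  distinguishing π Gπ π-stab =
    [ (λ π-preserves → crownColouring-preserving-trivial n-1≤k² plus {π} Gπ π-preserves π-stab)
    , (λ π-swaps → contradiction π-stab (crownColouring-swapping-impossible n-1≤k² {π} π-aut π-swaps))
    ]′ (preserves-or-swaps {π = π} π-aut)
    where
    π-aut : IsAut π
    π-aut = IsSubgroupOfAut.aut sub π Gπ

proposition4p4 : (n : ℕ) → 3 ≤ n → (G : Perm n → Set) →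
    IsSubgroupOfAut G → VertexTransitive G → EdgeTransitive G →
    PlusIsDiagAlt G →
    (k : ℕ) → IsCeilSqrt (n ∸ 1) k → IsDistinguishingNumber G k
proposition4p4 (suc (suc (suc r))) (s≤s (s≤s (s≤s _))) G sub _ _ plus k (n-1≤k² , k-least) =
  distinguishing-upperBound sub plus n-1≤k² , λ m c c-dist → k-least m (distinguishing-lowerBound plus c-dist)
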